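{- Let $A=(a,\,(u+1)a+d,\,(3u+1)a+3d,\,(7u+1)a+7d,\,(29u+1)a+29d)$, where $d$ is a positive integer with $\gcd(a,d)=1$, $u\ge 3$ is an integer, and $a\ge 2$. Let $p$ be a positive divisor of $a$ with $p\ne a$. Then $$F\left(\frac{\langle A\rangle}{p}\right)=\frac{a}{p}\left(\left\lfloor\frac{a-p}{29}\right\rfloor+ua+d+\varphi_3\big((a-p)\bmod 29\big)\right)-(ua+d),$$ where $(\varphi_3(i))_{0\le i\le 28}=(-1,0,1,0,1,2,1,0,1,2,1,2,3,2,1,2,3,2,3,4,3,2,3,4,3,4,5,4,3)$.
   Context: $\langle A\rangle$ is the set of non-negative integer linear combinations of the entries of $A$, and $\frac{\langle A\rangle}{p}=\{x\in\mathbb{N}\mid px\in\langle A\rangle\}$ (with $\mathbb{N}$ the non-negative integers), a numerical semigroup. $F(S)$ is the largest integer not in the numerical semigroup $S$. $(a-p)\bmod 29$ denotes the remainder in $\{0,\dots,28\}$. -}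

module Defs where

open import Data.Nat using (ℕ; _+_; _*_; _∸_; NonZero)
open import Data.Nat.DivMod using (_/_; _mod_)
open import Data.Integer as ℤ using (ℤ; +_; -[1+_])
open import Data.Fin using (Fin)
open import Data.Vec using (Vec; []; _∷_; lookup; zipWith; sum)
open import Data.Product using (Σ; ∃; _×_)
open import Relation.Binary.PropositionalEquality using (_≡_)
open import Relation.Nullary using (¬_)

_∈⟨_⟩ : ∀ {n} → ℕ → Vec ℕ n → Set
x ∈⟨ A ⟩ = Σ (Vec ℕ _) λ c → sum (zipWith _*_ c A) ≡ x

_∈⟨_⟩/_ : ∀ {n} → ℕ → Vec ℕ n → ℕ → Set
x ∈⟨ A ⟩/ p = (p * x) ∈⟨ A ⟩

_∈ℤ_ : ℤ → (ℕ → Set) → Set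
z ∈ℤ S = ∃ λ n → z ≡ + n × S n

IsFrobenius : (ℕ → Set) → ℤ → Set
IsFrobenius S f = ¬ (f ∈ℤ S) × (∀ (z : ℤ) → f ℤ.< z → z ∈ℤ S)

gensA : ℕ → ℕ → ℕ → Vec ℕ 5
gensA a d u =
  a ∷ ((u + 1) * a + d) ∷ ((3 * u + 1) * a + 3 * d) ∷
  ((7 * u + 1) * a + 7 * d) ∷ ((29 * u + 1) * a + 29 * d) ∷ []

φ₃vec : Vec ℤ 29
φ₃vec = -[1+ 0 ] ∷ + 0 ∷ + 1 ∷ + 0 ∷ + 1 ∷ + 2 ∷ + 1 ∷ + 0 ∷ + 1 ∷ + 2 ∷
        + 1 ∷ + 2 ∷ + 3 ∷ + 2 ∷ + 1 ∷ + 2 ∷ + 3 ∷ + 2 ∷ + 3 ∷ + 4 ∷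
        + 3 ∷ + 2 ∷ + 3 ∷ + 4 ∷ + 3 ∷ + 4 ∷ + 5 ∷ + 4 ∷ + 3 ∷ []

φ₃ : Fin 29 → ℤ
φ₃ i = lookup φ₃vec i

frobFormula : (a d u p : ℕ) → .{{NonZero p}} → ℤ
frobFormula a d u p =
  (+ (a / p)) ℤ.* (+ ((a ∸ p) / 29) ℤ.+ + (u * a + d) ℤ.+ φ₃ ((a ∸ p) mod 29))
  ℤ.- + (u * a + d)

module Submission where

-- Write a = q p and h = u a + d.  The generators are a and a + k h for the coins k = 1, 3, 7, 29, so
-- ⟨A⟩ = {N a + M h ∣ N ≥ minCoins M}, minCoins M being the fewest coins summing to M; as p is coprime
-- to h, ⟨A⟩/p = {N q + m h ∣ N ≥ minCoins (p m)}.  Since minCoins M ≤ minCoins (M + 1) + 3 and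
-- 3 p q ≤ h, the corner W m = minCoins (p m) q + m h of this staircase is nondecreasing in m.  As
-- gcd (q, h) = 1, every X ≥ (q - 1) h is N q + m h with m < q, and when also N < h this is its only
-- representation.  Hence W (q - 1) - q = (minCoins (a - p) - 1) q + (q - 1) h is the largest gap,
-- and ⌊M/29⌋ + φ₃ (M mod 29) is exactly minCoins M - 1.

open import Defs
open import Data.Nat
  using ( ℕ; zero; suc; _+_; _*_; _∸_; _≤_; _<_; _≤?_; _/_; _%_; pred; NonZero; >-nonZero; >-nonZero⁻¹
        ; z≤n; s≤s; _≤′_; ≤′-refl; ≤′-step)
open import Data.Nat.Properties
open import Data.Nat.DivMod using (_mod_; m≡m%n+[m/n]*n; m%n<n; [m+kn]%n≡m%n; +-distrib-/-∣ʳ; m*n/n≡m)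
open import Data.Nat.Divisibility using (_∣_; divides; n∣m*n; m∣m*n; ∣m+n∣m⇒∣n; ∣-trans; ∣⇒≤)
open import Data.Nat.Coprimality using (Coprime; coprime-divisor; coprime-Bézout; gcd≡1⇒coprime)
open import Data.Nat.GCD using (gcd; module Bézout)
open import Data.Nat.Tactic.RingSolver using (solve-∀)
open import Data.Integer as ℤ using (+_; +<+)
import Data.Integer.Properties as ℤ
import Data.Integer.Tactic.RingSolver as ℤ-Solver
open import Data.Fin using (toℕ)
open import Data.Fin.Properties using (all?; toℕ-fromℕ<)
open import Data.Vec using (Vec; []; _∷_; map; zipWith; sum)
open import Data.Vec.Relation.Unary.All as All using (All; []; _∷_)
open import Data.Product using (∃-syntax; ∃₂; _×_; _,_; proj₁; proj₂)
open import Data.Empty using (⊥-elim)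
open import Function.Bundles using (_⇔_; mk⇔; module Equivalence)
import Function.Properties.Equivalence as ⇔
open import Relation.Nullary using (¬_)
open import Relation.Nullary.Decidable using (True; toWitness)
open import Relation.Binary using (tri<; tri≈; tri>)
open import Relation.Binary.PropositionalEquality

IsFrobenius-resp-⇔ : ∀ {S T : ℕ → Set} {f} → (∀ x → S x ⇔ T x) → IsFrobenius S f → IsFrobenius T f
IsFrobenius-resp-⇔ {S} {T} {f} S⇔T (f∉S , >f⇒∈S) = f∉T , >f⇒∈T
  where
    f∉T : ¬ (f ∈ℤ T)
    f∉T (n , f≡n , Tn) = f∉S (n , f≡n , Equivalence.from (S⇔T n) Tn)
    >f⇒∈T : ∀ z → f ℤ.< z → z ∈ℤ T
    >f⇒∈T z f<z = let (n , z≡n , Sn) = >f⇒∈S z f<z in n , z≡n , Equivalence.to (S⇔T n) Sn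

∣-coprime : ∀ {d m n} → d ∣ m → Coprime m n → Coprime d n
∣-coprime d∣m cop (i∣d , i∣n) = cop (∣-trans i∣d d∣m , i∣n)

coprime-*+ : ∀ {a d} u → Coprime a d → Coprime a (u * a + d)
coprime-*+ u cop (i∣a , i∣ua+d) = cop (i∣a , ∣m+n∣m⇒∣n i∣ua+d (∣-trans i∣a (n∣m*n u)))

coprime-inverse : ∀ {n h} → Coprime (2 + n) h → ∃₂ λ t s → t * h ≡ 1 + s * (2 + n)
coprime-inverse {n} {h} cop with coprime-Bézout cop
... | Bézout.-+ s t 1+sq≡th = t , s , sym 1+sq≡th
-- Here y h ≡ -1 (mod 2 + n), so (1 + n) y inverts h.
... | Bézout.+- (suc x) y 1+yh≡xq = suc n * y , x + n * suc x , +-cancelʳ-≡ (2 + n) _ _ (begin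
      suc n * y * h + (2 + n)        ≡⟨ expand n y h ⟩
      suc n * (1 + y * h) + 1        ≡⟨ cong (λ z → suc n * z + 1) 1+yh≡xq ⟩
      suc n * (suc x * (2 + n)) + 1  ≡⟨ regroup n x ⟩
      1 + (x + n * suc x) * (2 + n) + (2 + n) ∎)
  where
    open ≡-Reasoning
    expand : ∀ n y h → suc n * y * h + (2 + n) ≡ suc n * (1 + y * h) + 1
    expand = solve-∀
    regroup : ∀ n x → suc n * (suc x * (2 + n)) + 1 ≡ 1 + (x + n * suc x) * (2 + n) + (2 + n)
    regroup = solve-∀

coprime⇒∃-representation : ∀ {q' h} → Coprime (suc q') h → ∀ X → q' * h ≤ X →
  ∃₂ λ N m → m ≤ q' × X ≡ N * suc q' + m * h
coprime⇒∃-representation {zero} _ X _ = X , 0 , z≤n , sym (trans (+-identityʳ (X * 1)) (*-identityʳ X))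
coprime⇒∃-representation {suc n} {h} cop X q'h≤X
  with t , s , th≡1+sq ← coprime-inverse cop = k * h ∸ X * s , m , m≤q' , X≡
  where
    open ≡-Reasoning
    q m k : ℕ
    q = 2 + n
    -- m h ≡ X t h ≡ X (mod q)
    m = X * t % q
    k = X * t / q
    m≤q' : m ≤ suc n
    m≤q' = m<1+n⇒m≤n (m%n<n (X * t) q)
    mh≤X : m * h ≤ X
    mh≤X = ≤-trans (*-monoˡ-≤ h m≤q') q'h≤X
    mh+khq≡X+Xsq : m * h + k * h * q ≡ X + X * s * q
    mh+khq≡X+Xsq = begin
      m * h + k * h * q  ≡⟨ factor m k h q ⟩
      (m + k * q) * h    ≡⟨ cong (_* h) (m≡m%n+[m/n]*n (X * t) q) ⟨
      X * t * h          ≡⟨ *-assoc X t h ⟩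
      X * (t * h)        ≡⟨ cong (X *_) th≡1+sq ⟩
      X * (1 + s * q)    ≡⟨ expand X s q ⟩
      X + X * s * q      ∎
      where
        factor : ∀ m k h q → m * h + k * h * q ≡ (m + k * q) * h
        factor = solve-∀
        expand : ∀ X s q → X * (1 + s * q) ≡ X + X * s * q
        expand = solve-∀
    X≡ : X ≡ (k * h ∸ X * s) * q + m * h
    X≡ = begin
      X                                    ≡⟨ m+[n∸m]≡n mh≤X ⟨
      m * h + (X ∸ m * h)                  ≡⟨ +-comm (m * h) _ ⟩
      (X ∸ m * h) + m * h                  ≡⟨ cong (_+ m * h) (begin
        X ∸ m * h                             ≡⟨ m+n∸n≡m (X ∸ m * h) (X * s * q) ⟨
        X ∸ m * h + X * s * q ∸ X * s * q     ≡⟨ cong (_∸ X * s * q) (+-∸-comm (X * s * q) mh≤X) ⟨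
        X + X * s * q ∸ m * h ∸ X * s * q     ≡⟨ cong (λ y → y ∸ m * h ∸ X * s * q) mh+khq≡X+Xsq ⟨
        m * h + k * h * q ∸ m * h ∸ X * s * q ≡⟨ cong (_∸ X * s * q) (m+n∸m≡n (m * h) (k * h * q)) ⟩
        k * h * q ∸ X * s * q                 ≡⟨ *-distribʳ-∸ q (k * h) (X * s) ⟨
        (k * h ∸ X * s) * q                   ∎) ⟩
      (k * h ∸ X * s) * q + m * h          ∎

coprime⇒gap : ∀ {a h N M o P} → Coprime a h → N * a + M * h ≡ o * a + P * h → M ≤ P →
  N * a ≡ o * a + (P ∸ M) * h × a ∣ P ∸ M
coprime⇒gap {a} {h} {N} {M} {o} {P} cop eq M≤P = Na≡ , coprime-divisor cop a∣h[P∸M]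
  where
    open ≡-Reasoning
    Na≡ : N * a ≡ o * a + (P ∸ M) * h
    Na≡ = +-cancelʳ-≡ (M * h) _ _ (begin
      N * a + M * h                  ≡⟨ eq ⟩
      o * a + P * h                  ≡⟨ cong (λ x → o * a + x * h) (m∸n+n≡m M≤P) ⟨
      o * a + (P ∸ M + M) * h        ≡⟨ cong (_+_ (o * a)) (*-distribʳ-+ h (P ∸ M) M) ⟩
      o * a + ((P ∸ M) * h + M * h)  ≡⟨ +-assoc (o * a) _ _ ⟨
      o * a + (P ∸ M) * h + M * h    ∎)
    a∣h[P∸M] : a ∣ h * (P ∸ M)
    a∣h[P∸M] = subst (a ∣_) (*-comm (P ∸ M) h) (∣m+n∣m⇒∣n (divides N (sym Na≡)) (n∣m*n o))

coprime⇒representation-unique : ∀ {a h N M o P} → Coprime a h → P < a → o < h →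
  N * a + M * h ≡ o * a + P * h → N ≡ o × M ≡ P
coprime⇒representation-unique {a} {h} {N} {M} {o} {P} cop P<a o<h eq with <-cmp M P
... | tri< M<P _ _ = ⊥-elim (<⇒≱ P<a (≤-trans a≤P∸M (m∸n≤m P M)))
  where
    a≤P∸M : a ≤ P ∸ M
    a≤P∸M = ∣⇒≤ {{>-nonZero (m<n⇒0<n∸m M<P)}} (proj₂ (coprime⇒gap {N = N} {M} {o} cop eq (<⇒≤ M<P)))
... | tri> _ _ P<M = ⊥-elim (<⇒≱ (*-monoˡ-< a {{a≢0}} o<h) (begin
      h * a          ≡⟨ *-comm h a ⟩
      a * h          ≤⟨ *-monoˡ-≤ h a≤M∸P ⟩
      (M ∸ P) * h    ≤⟨ m≤n+m _ (N * a) ⟩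
      N * a + (M ∸ P) * h  ≡⟨ oa≡ ⟨
      o * a          ∎))
  where
    open ≤-Reasoning
    a≢0 : NonZero a
    a≢0 = >-nonZero (≤-<-trans z≤n P<a)
    gap : o * a ≡ N * a + (M ∸ P) * h × a ∣ M ∸ P
    gap = coprime⇒gap {N = o} {P} {N} cop (sym eq) (<⇒≤ P<M)
    oa≡ : o * a ≡ N * a + (M ∸ P) * h
    oa≡ = proj₁ gap
    a≤M∸P : a ≤ M ∸ P
    a≤M∸P = ∣⇒≤ {{>-nonZero (m<n⇒0<n∸m P<M)}} (proj₂ gap)
... | tri≈ _ refl _ = *-cancelʳ-≡ N o a {{>-nonZero (≤-<-trans z≤n P<a)}} (+-cancelʳ-≡ (M * h) _ _ eq) , refl

Staircase : (ℕ → ℕ) → ℕ → ℕ → ℕ → Set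
Staircase g q h x = ∃₂ λ N m → x ≡ N * q + m * h × g m ≤ N

staircase-mono : ∀ {g : ℕ → ℕ} {c q h} → (∀ m → g m ≤ c + g (suc m)) → c * q ≤ h →
  ∀ {m n} → m ≤ n → g m * q + m * h ≤ g n * q + n * h
staircase-mono {g} {c} {q} {h} g-drop cq≤h m≤n = go (≤⇒≤′ m≤n)
  where
    open ≤-Reasoning
    step : ∀ m → g m * q + m * h ≤ g (suc m) * q + suc m * h
    step m = begin
      g m * q + m * h                  ≤⟨ +-monoˡ-≤ (m * h) (*-monoˡ-≤ q (g-drop m)) ⟩
      (c + g (suc m)) * q + m * h      ≡⟨ regroup c (g (suc m)) q (m * h) ⟩
      c * q + (g (suc m) * q + m * h)  ≤⟨ +-monoˡ-≤ _ cq≤h ⟩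
      h + (g (suc m) * q + m * h)      ≡⟨ shift h (g (suc m) * q) m ⟩
      g (suc m) * q + suc m * h        ∎
      where
        regroup : ∀ c y q z → (c + y) * q + z ≡ c * q + (y * q + z)
        regroup = solve-∀
        shift : ∀ h y m → h + (y + m * h) ≡ y + suc m * h
        shift = solve-∀
    go : ∀ {m n} → m ≤′ n → g m * q + m * h ≤ g n * q + n * h
    go ≤′-refl = ≤-refl
    go (≤′-step m≤′n) = ≤-trans (go m≤′n) (step _)

staircase-frobenius : ∀ {g : ℕ → ℕ} {c q' h o} → Coprime (suc q') h →
  (∀ m → g m ≤ c + g (suc m)) → c * suc q' ≤ h → g q' ≡ suc o → o < h → IsFrobenius (Staircase g (suc q') h) (+ (o * suc q' + q' * h))
staircase-frobenius {g} {c} {q'} {h} {o} cop g-drop cq≤h gq'≡1+o o<h = F∉S , >F⇒∈S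
  where
    q F : ℕ
    q = suc q'
    F = o * q + q' * h
    F∉S : ¬ ((+ F) ∈ℤ Staircase g q h)
    F∉S (_ , refl , N , m , F≡ , gm≤N)
      with refl , refl ← coprime⇒representation-unique {N = N} {m} cop (n<1+n q') o<h (sym F≡)
      = 1+n≰n (subst (_≤ o) gq'≡1+o gm≤N)
    g≤ : ∀ {N m X} → m ≤ q' → X ≡ N * q + m * h → F < X → g m ≤ N
    g≤ {N} {m} {X} m≤q' X≡ F<X = m<1+n⇒m≤n (*-cancelʳ-< q (g m) (suc N) (+-cancelʳ-< (m * h) _ _ (begin-strict
      g m * q + m * h      ≤⟨ staircase-mono g-drop cq≤h m≤q' ⟩
      g q' * q + q' * h    ≡⟨ cong (λ y → y * q + q' * h) gq'≡1+o ⟩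
      suc o * q + q' * h   ≡⟨ +-assoc q (o * q) (q' * h) ⟩
      q + F                <⟨ +-monoʳ-< q F<X ⟩
      q + X                ≡⟨ cong (_+_ q) X≡ ⟩
      q + (N * q + m * h)  ≡⟨ +-assoc q (N * q) (m * h) ⟨
      suc N * q + m * h    ∎)))
      where open ≤-Reasoning
    >F⇒∈S : ∀ z → + F ℤ.< z → z ∈ℤ Staircase g q h
    >F⇒∈S (+ X) (+<+ F<X) =
      let (N , m , m≤q' , X≡) = coprime⇒∃-representation cop X (≤-trans (m≤n+m (q' * h) (o * q)) (<⇒≤ F<X))
      in X , refl , N , m , X≡ , g≤ m≤q' X≡ F<X

infix 8 _·_
_·_ : ∀ {n} → Vec ℕ n → Vec ℕ n → ℕ
c · ks = sum (zipWith _*_ c ks)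

·-map-shift : ∀ {n} a h (c ks : Vec ℕ n) → c · map (λ k → a + k * h) ks ≡ sum c * a + (c · ks) * h
·-map-shift a h [] [] = refl
·-map-shift a h (x ∷ c) (k ∷ ks) = begin
  x * (a + k * h) + c · map (λ k → a + k * h) ks  ≡⟨ cong (_+_ (x * (a + k * h))) (·-map-shift a h c ks) ⟩
  x * (a + k * h) + (sum c * a + (c · ks) * h)    ≡⟨ regroup x a k h (sum c) (c · ks) ⟩
  (x + sum c) * a + (x * k + c · ks) * h           ∎
  where
    open ≡-Reasoning
    regroup : ∀ x a k h s t → x * (a + k * h) + (s * a + t * h) ≡ (x + s) * a + (x * k + t) * h
    regroup = solve-∀

∈⟨shifted⟩⇔ : ∀ {n} a h (ks : Vec ℕ n) y →
  y ∈⟨ a ∷ map (λ k → a + k * h) ks ⟩ ⇔ ∃₂ λ N c → y ≡ N * a + (c · ks) * h × sum c ≤ N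
∈⟨shifted⟩⇔ a h ks y = mk⇔
  (λ { (n₀ ∷ c , eq) → n₀ + sum c , c , trans (sym eq) (·-∷-shifted n₀ c) , m≤n+m (sum c) n₀ })
  (λ { (N , c , y≡ , sum≤N) → N ∸ sum c ∷ c ,
         trans (·-∷-shifted (N ∸ sum c) c)
               (trans (cong (λ x → x * a + (c · ks) * h) (m∸n+n≡m sum≤N)) (sym y≡)) })
  where
    ·-∷-shifted : ∀ n₀ c → (n₀ ∷ c) · (a ∷ map (λ k → a + k * h) ks) ≡ (n₀ + sum c) * a + (c · ks) * h
    ·-∷-shifted n₀ c = begin
      n₀ * a + c · map (λ k → a + k * h) ks  ≡⟨ cong (_+_ (n₀ * a)) (·-map-shift a h c ks) ⟩
      n₀ * a + (sum c * a + (c · ks) * h)    ≡⟨ +-assoc (n₀ * a) _ _ ⟨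
      n₀ * a + sum c * a + (c · ks) * h      ≡⟨ cong (_+ (c · ks) * h) (*-distribʳ-+ a n₀ (sum c)) ⟨
      (n₀ + sum c) * a + (c · ks) * h        ∎
      where open ≡-Reasoning

·-≤ : ∀ {n K} {ks : Vec ℕ n} → All (_≤ K) ks → ∀ c → c · ks ≤ sum c * K
·-≤ [] [] = z≤n
·-≤ {K = K} {k ∷ ks} (k≤K ∷ ks≤K) (x ∷ c) = begin
  x * k + c · ks     ≤⟨ +-mono-≤ (*-monoʳ-≤ x k≤K) (·-≤ ks≤K c) ⟩
  x * K + sum c * K  ≡⟨ *-distribʳ-+ K x (sum c) ⟨
  (x + sum c) * K    ∎
  where open ≤-Reasoning

f[x*k+M]≤x+f[M] : ∀ (f : ℕ → ℕ) k → (∀ M → f (k + M) ≤ suc (f M)) → ∀ x M → f (x * k + M) ≤ x + f M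
f[x*k+M]≤x+f[M] f k step zero M = ≤-refl
f[x*k+M]≤x+f[M] f k step (suc x) M = begin
  f (k + x * k + M)    ≡⟨ cong f (+-assoc k (x * k) M) ⟩
  f (k + (x * k + M))  ≤⟨ step (x * k + M) ⟩
  suc (f (x * k + M))  ≤⟨ s≤s (f[x*k+M]≤x+f[M] f k step x M) ⟩
  suc x + f M          ∎
  where open ≤-Reasoning

f[c·ks]≤sum[c] : ∀ {n} (f : ℕ → ℕ) {ks : Vec ℕ n} → f 0 ≡ 0 →
  All (λ k → ∀ M → f (k + M) ≤ suc (f M)) ks → ∀ c → f (c · ks) ≤ sum c
f[c·ks]≤sum[c] f f0≡0 [] [] = ≤-reflexive f0≡0
f[c·ks]≤sum[c] f {k ∷ ks} f0≡0 (step ∷ steps) (x ∷ c) =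
  ≤-trans (f[x*k+M]≤x+f[M] f k step x (c · ks)) (+-monoʳ-≤ x (f[c·ks]≤sum[c] f f0≡0 steps c))

coins : Vec ℕ 4
coins = 1 ∷ 3 ∷ 7 ∷ 29 ∷ []

greedy-1-3-7 : ℕ → ℕ
greedy-1-3-7 r = r / 7 + r % 7 / 3 + r % 7 % 3

-- Greedy change; minCoins-minimal and minCoins-attained show that it is optimal for these coins.
minCoins : ℕ → ℕ
minCoins M = M / 29 + greedy-1-3-7 (M % 29)

minCoins-+-*29 : ∀ r k → minCoins (r + k * 29) ≡ minCoins r + k
minCoins-+-*29 r k = begin
  (r + k * 29) / 29 + greedy-1-3-7 ((r + k * 29) % 29)
    ≡⟨ cong₂ _+_ (+-distrib-/-∣ʳ r (n∣m*n k)) (cong greedy-1-3-7 ([m+kn]%n≡m%n r k 29)) ⟩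
  r / 29 + k * 29 / 29 + greedy-1-3-7 (r % 29)
    ≡⟨ cong (λ x → r / 29 + x + greedy-1-3-7 (r % 29)) (m*n/n≡m k 29) ⟩
  r / 29 + k + greedy-1-3-7 (r % 29)
    ≡⟨ swap (r / 29) k _ ⟩
  minCoins r + k
    ∎
  where
    open ≡-Reasoning
    swap : ∀ x y z → x + y + z ≡ x + z + y
    swap = solve-∀

minCoins-reduce : ∀ i M → minCoins (i + M) ≡ minCoins (i + M % 29) + M / 29
minCoins-reduce i M = begin
  minCoins (i + M)                        ≡⟨ cong (λ x → minCoins (i + x)) (m≡m%n+[m/n]*n M 29) ⟩
  minCoins (i + (M % 29 + M / 29 * 29))   ≡⟨ cong minCoins (+-assoc i _ _) ⟨
  minCoins (i + M % 29 + M / 29 * 29)     ≡⟨ minCoins-+-*29 (i + M % 29) (M / 29) ⟩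
  minCoins (i + M % 29) + M / 29          ∎
  where open ≡-Reasoning

-- Since minCoins (r + k * 29) ≡ minCoins r + k, such an inequality only needs checking on the
-- residues r < 29, which is done by evaluation.
minCoins-shift-≤ : ∀ i j e → True (allUpTo? (λ r → minCoins (i + r) ≤? e + minCoins (j + r)) 29) →
  ∀ M → minCoins (i + M) ≤ e + minCoins (j + M)
minCoins-shift-≤ i j e residues M = begin
  minCoins (i + M)                   ≡⟨ minCoins-reduce i M ⟩
  minCoins (i + r) + k               ≤⟨ +-monoˡ-≤ k (toWitness residues (m%n<n M 29)) ⟩
  e + minCoins (j + r) + k           ≡⟨ +-assoc e _ k ⟩
  e + (minCoins (j + r) + k)         ≡⟨ cong (_+_ e) (minCoins-reduce j M) ⟨
  e + minCoins (j + M)               ∎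
  where
    open ≤-Reasoning
    r k : ℕ
    r = M % 29
    k = M / 29

minCoins-+coin : All (λ k → ∀ M → minCoins (k + M) ≤ suc (minCoins M)) coins
minCoins-+coin =
  minCoins-shift-≤ 1 0 1 _ ∷ minCoins-shift-≤ 3 0 1 _ ∷ minCoins-shift-≤ 7 0 1 _ ∷ minCoins-shift-≤ 29 0 1 _ ∷ []

minCoins-≤-+ : ∀ j M → minCoins M ≤ 3 * j + minCoins (j + M)
minCoins-≤-+ zero M = ≤-refl
minCoins-≤-+ (suc j) M = begin
  minCoins M                             ≤⟨ minCoins-≤-+ j M ⟩
  3 * j + minCoins (j + M)               ≤⟨ +-monoʳ-≤ (3 * j) (minCoins-shift-≤ 0 1 3 _ (j + M)) ⟩
  3 * j + (3 + minCoins (suc (j + M)))   ≡⟨ regroup j (minCoins (suc (j + M))) ⟩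
  3 * suc j + minCoins (suc j + M)       ∎
  where
    open ≤-Reasoning
    regroup : ∀ j x → 3 * j + (3 + x) ≡ 3 * suc j + x
    regroup = solve-∀

minCoins-≤ : ∀ M → minCoins M ≤ M
minCoins-≤ zero = z≤n
minCoins-≤ (suc M) = ≤-trans (All.head minCoins-+coin M) (s≤s (minCoins-≤ M))

minCoins-minimal : ∀ c → minCoins (c · coins) ≤ sum c
minCoins-minimal = f[c·ks]≤sum[c] minCoins refl minCoins-+coin

minCoins-attained : ∀ M → ∃[ c ] c · coins ≡ M × sum c ≡ minCoins M
minCoins-attained M = c , value , count
  where
    open ≡-Reasoning
    r : ℕ
    r = M % 29
    c : Vec ℕ 4
    c = r % 7 % 3 ∷ r % 7 / 3 ∷ r / 7 ∷ M / 29 ∷ []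
    value : c · coins ≡ M
    value = begin
      r % 7 % 3 * 1 + (r % 7 / 3 * 3 + (r / 7 * 7 + (M / 29 * 29 + 0)))
        ≡⟨ regroup (r % 7 % 3) (r % 7 / 3) (r / 7) (M / 29) ⟩
      r % 7 % 3 + r % 7 / 3 * 3 + r / 7 * 7 + M / 29 * 29
        ≡⟨ cong (λ x → x + r / 7 * 7 + M / 29 * 29) (m≡m%n+[m/n]*n (r % 7) 3) ⟨
      r % 7 + r / 7 * 7 + M / 29 * 29
        ≡⟨ cong (_+ M / 29 * 29) (m≡m%n+[m/n]*n r 7) ⟨
      r + M / 29 * 29
        ≡⟨ m≡m%n+[m/n]*n M 29 ⟨
      M ∎
      where
        regroup : ∀ x y z w → x * 1 + (y * 3 + (z * 7 + (w * 29 + 0))) ≡ x + y * 3 + z * 7 + w * 29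
        regroup = solve-∀
    count : sum c ≡ minCoins M
    count = reverse (r % 7 % 3) (r % 7 / 3) (r / 7) (M / 29)
      where
        reverse : ∀ x y z w → x + (y + (z + (w + 0))) ≡ w + (z + y + x)
        reverse = solve-∀

coins≤29 : All (_≤ 29) coins
coins≤29 = toWitness {a? = All.all? (_≤? 29) coins} _

minCoins-pos : ∀ {M} → 0 < M → 0 < minCoins M
minCoins-pos {M} 0<M = bound (minCoins-attained M)
  where
    open ≤-Reasoning
    bound : (∃[ c ] c · coins ≡ M × sum c ≡ minCoins M) → 0 < minCoins M
    bound (c , c·coins≡M , sum≡) = *-cancelʳ-< 29 0 (minCoins M) (begin-strict
      0                    <⟨ 0<M ⟩
      M                    ≡⟨ c·coins≡M ⟨
      c · coins            ≤⟨ ·-≤ coins≤29 c ⟩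
      sum c * 29           ≡⟨ cong (_* 29) sum≡ ⟩
      minCoins M * 29      ∎)

gensA-shifted : ∀ a d u → gensA a d u ≡ a ∷ map (λ k → a + k * (u * a + d)) coins
gensA-shifted a d u =
  cong (a ∷_) (cong₂ _∷_ (coin₁ u a d)
              (cong₂ _∷_ (coinₖ 3 u a d) (cong₂ _∷_ (coinₖ 7 u a d) (cong (_∷ []) (coinₖ 29 u a d)))))
  where
    coin₁ : ∀ u a d → (u + 1) * a + d ≡ a + 1 * (u * a + d)
    coin₁ = solve-∀
    coinₖ : ∀ k u a d → (k * u + 1) * a + k * d ≡ a + k * (u * a + d)
    coinₖ = solve-∀

∈⟨gensA⟩⇔ : ∀ a d u y → y ∈⟨ gensA a d u ⟩ ⇔ ∃₂ λ N M → y ≡ N * a + M * (u * a + d) × minCoins M ≤ N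
∈⟨gensA⟩⇔ a d u y = ⇔.trans shifted (⇔.trans (∈⟨shifted⟩⇔ a h coins y) (mk⇔ to from))
  where
    h : ℕ
    h = u * a + d
    shifted : y ∈⟨ gensA a d u ⟩ ⇔ y ∈⟨ a ∷ map (λ k → a + k * h) coins ⟩
    shifted = mk⇔ (subst (y ∈⟨_⟩) (gensA-shifted a d u)) (subst (y ∈⟨_⟩) (sym (gensA-shifted a d u)))
    Paid Counted : Set
    Paid = ∃₂ λ N c → y ≡ N * a + (c · coins) * h × sum c ≤ N
    Counted = ∃₂ λ N M → y ≡ N * a + M * h × minCoins M ≤ N
    to : Paid → Counted
    to (N , c , y≡ , sum≤N) = N , c · coins , y≡ , ≤-trans (minCoins-minimal c) sum≤N
    from : Counted → Paid
    from (N , M , y≡ , min≤N) = optimal (minCoins-attained M)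
      where
        optimal : (∃[ c ] c · coins ≡ M × sum c ≡ minCoins M) → Paid
        optimal (c , c·coins≡M , sum≡) =
          N , c , trans y≡ (cong (λ x → N * a + x * h) (sym c·coins≡M)) , subst (_≤ N) (sym sum≡) min≤N

∈⟨gensA⟩/⇔ : ∀ {q p} .{{_ : NonZero p}} d u → Coprime (q * p) (u * (q * p) + d) → ∀ x →
  x ∈⟨ gensA (q * p) d u ⟩/ p ⇔ Staircase (λ m → minCoins (p * m)) q (u * (q * p) + d) x
∈⟨gensA⟩/⇔ {q} {p} d u cop x = ⇔.trans (∈⟨gensA⟩⇔ (q * p) d u (p * x)) (mk⇔ to from)
  where
    a h : ℕ
    a = q * p
    h = u * a + d
    cop-p : Coprime p h
    cop-p = ∣-coprime (n∣m*n q) cop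
    to : (∃₂ λ N M → p * x ≡ N * a + M * h × minCoins M ≤ N) → Staircase (λ m → minCoins (p * m)) q h x
    to (N , M , px≡ , min≤N) = from-quotient (coprime-divisor cop-p p∣hM)
      where
        p∣Na : p ∣ N * a
        p∣Na = subst (p ∣_) (*-assoc N q p) (n∣m*n (N * q))
        p∣hM : p ∣ h * M
        p∣hM = subst (p ∣_) (*-comm M h) (∣m+n∣m⇒∣n (subst (p ∣_) px≡ (m∣m*n x)) p∣Na)
        regroup : ∀ N q p m h → N * (q * p) + m * p * h ≡ p * (N * q + m * h)
        regroup = solve-∀
        from-quotient : p ∣ M → Staircase (λ m → minCoins (p * m)) q h x
        from-quotient (divides m refl) =
          N , m , *-cancelˡ-≡ x _ p (trans px≡ (regroup N q p m h)) , subst (λ y → minCoins y ≤ N) (*-comm m p) min≤N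
    from : Staircase (λ m → minCoins (p * m)) q h x → ∃₂ λ N M → p * x ≡ N * a + M * h × minCoins M ≤ N
    from (N , m , x≡ , min≤N) = N , p * m , trans (cong (p *_) x≡) (regroup N q p m h) , min≤N
      where
        regroup : ∀ N q p m h → p * (N * q + m * h) ≡ N * (q * p) + p * m * h
        regroup = solve-∀

φ₃-minCoins : ∀ i → φ₃ i ≡ + minCoins (toℕ i) ℤ.- + 1
φ₃-minCoins = toWitness {a? = all? (λ i → φ₃ i ℤ.≟ + minCoins (toℕ i) ℤ.- + 1)} _

div+φ₃-mod≡minCoins-1 : ∀ M → + (M / 29) ℤ.+ φ₃ (M mod 29) ≡ + minCoins M ℤ.- + 1
div+φ₃-mod≡minCoins-1 M = begin
  + (M / 29) ℤ.+ φ₃ (M mod 29)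
    ≡⟨ cong (ℤ._+_ (+ (M / 29))) (φ₃-minCoins (M mod 29)) ⟩
  + (M / 29) ℤ.+ (+ minCoins (toℕ (M mod 29)) ℤ.- + 1)
    ≡⟨ cong (λ r → + (M / 29) ℤ.+ (+ minCoins r ℤ.- + 1)) (toℕ-fromℕ< (m%n<n M 29)) ⟩
  + (M / 29) ℤ.+ (+ minCoins (M % 29) ℤ.- + 1)
    ≡⟨ regroup (+ (M / 29)) (+ minCoins (M % 29)) ⟩
  + minCoins (M % 29) ℤ.+ + (M / 29) ℤ.- + 1
    ≡⟨ cong (ℤ._- + 1) (ℤ.pos-+ (minCoins (M % 29)) (M / 29)) ⟨
  + (minCoins (M % 29) + M / 29) ℤ.- + 1
    ≡⟨ cong (λ y → + y ℤ.- + 1) (minCoins-reduce 0 M) ⟨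
  + minCoins M ℤ.- + 1
    ∎
  where
    open ≡-Reasoning
    regroup : ∀ X C → X ℤ.+ (C ℤ.- + 1) ≡ C ℤ.+ X ℤ.- + 1
    regroup = ℤ-Solver.solve-∀

frobFormula≡ : ∀ n d u p .{{_ : NonZero p}} {o} → minCoins (p * suc n) ≡ suc o →
  frobFormula ((2 + n) * p) d u p ≡ + (o * (2 + n) + suc n * (u * ((2 + n) * p) + d))
frobFormula≡ n d u p {o} minCoins≡ = begin
  + (a / p) ℤ.* (+ ((a ∸ p) / 29) ℤ.+ + h ℤ.+ φ₃ ((a ∸ p) mod 29)) ℤ.- + h
    ≡⟨ cong₂ (λ Q P → + Q ℤ.* (+ (P / 29) ℤ.+ + h ℤ.+ φ₃ (P mod 29)) ℤ.- + h) (m*n/n≡m q p) a∸p≡P ⟩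
  + q ℤ.* (+ (P / 29) ℤ.+ + h ℤ.+ φ₃ (P mod 29)) ℤ.- + h
    ≡⟨ regroup (+ q) (+ (P / 29)) (+ h) (φ₃ (P mod 29)) ⟩
  + q ℤ.* (+ (P / 29) ℤ.+ φ₃ (P mod 29) ℤ.+ + h) ℤ.- + h
    ≡⟨ cong (λ Y → + q ℤ.* (Y ℤ.+ + h) ℤ.- + h)
            (trans (div+φ₃-mod≡minCoins-1 P) (cong (λ y → + y ℤ.- + 1) minCoins≡)) ⟩
  + q ℤ.* (+ suc o ℤ.- + 1 ℤ.+ + h) ℤ.- + h
    ≡⟨ expand (+ suc n) (+ o) (+ h) ⟩
  + o ℤ.* + q ℤ.+ + suc n ℤ.* + h
    ≡⟨ cong₂ ℤ._+_ (ℤ.pos-* o q) (ℤ.pos-* (suc n) h) ⟨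
  + (o * q) ℤ.+ + (suc n * h)
    ≡⟨ ℤ.pos-+ (o * q) (suc n * h) ⟨
  + (o * q + suc n * h)
    ∎
  where
    open ≡-Reasoning
    q a h P : ℕ
    q = 2 + n
    a = q * p
    h = u * a + d
    P = p * suc n
    a∸p≡P : a ∸ p ≡ P
    a∸p≡P = trans (m+n∸m≡n p (suc n * p)) (*-comm (suc n) p)
    regroup : ∀ Q X H Φ → Q ℤ.* (X ℤ.+ H ℤ.+ Φ) ℤ.- H ≡ Q ℤ.* (X ℤ.+ Φ ℤ.+ H) ℤ.- H
    regroup = ℤ-Solver.solve-∀
    expand : ∀ Q' O H → (+ 1 ℤ.+ Q') ℤ.* (+ 1 ℤ.+ O ℤ.- + 1 ℤ.+ H) ℤ.- H ≡ O ℤ.* (+ 1 ℤ.+ Q') ℤ.+ Q' ℤ.* H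
    expand = ℤ-Solver.solve-∀

quotient-frobenius : ∀ n d u p .{{_ : NonZero p}} → gcd ((2 + n) * p) d ≡ 1 → 3 ≤ u →
  IsFrobenius (λ x → x ∈⟨ gensA ((2 + n) * p) d u ⟩/ p) (frobFormula ((2 + n) * p) d u p)
quotient-frobenius n d u p gcd≡1 u≥3 =
  subst (IsFrobenius _) (sym (frobFormula≡ n d u p minCoins-P))
    (IsFrobenius-resp-⇔ (λ x → ⇔.sym (∈⟨gensA⟩/⇔ d u cop x))
      (staircase-frobenius {g = λ m → minCoins (p * m)} {c = 3 * p} cop-q drop 3pq≤h minCoins-P o<h))
  where
    open ≤-Reasoning
    q a h P : ℕ
    q = 2 + n
    a = q * p
    h = u * a + d
    P = p * suc n
    cop : Coprime a h
    cop = coprime-*+ u (gcd≡1⇒coprime gcd≡1)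
    cop-q : Coprime q h
    cop-q = ∣-coprime (m∣m*n p) cop
    drop : ∀ m → minCoins (p * m) ≤ 3 * p + minCoins (p * suc m)
    drop m = subst (λ y → minCoins (p * m) ≤ 3 * p + minCoins y) (sym (*-suc p m)) (minCoins-≤-+ p (p * m))
    3a≤h : 3 * a ≤ h
    3a≤h = ≤-trans (*-monoˡ-≤ a u≥3) (m≤m+n (u * a) d)
    3pq≤h : 3 * p * q ≤ h
    3pq≤h = subst (_≤ h) (regroup p q) 3a≤h
      where
        regroup : ∀ p q → 3 * (q * p) ≡ 3 * p * q
        regroup = solve-∀
    o : ℕ
    o = pred (minCoins P)
    minCoins-P : minCoins P ≡ suc o
    minCoins-P = sym (suc-pred (minCoins P) {{>-nonZero (minCoins-pos (>-nonZero⁻¹ P {{m*n≢0 p (suc n)}}))}})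
    o<h : o < h
    o<h = begin-strict
      o           <⟨ n<1+n o ⟩
      suc o       ≡⟨ minCoins-P ⟨
      minCoins P  ≤⟨ minCoins-≤ P ⟩
      P           ≡⟨ *-comm p (suc n) ⟩
      suc n * p   <⟨ m<n+m (suc n * p) (>-nonZero⁻¹ p) ⟩
      a           ≤⟨ m≤m+n a (2 * a) ⟩
      3 * a       ≤⟨ 3a≤h ⟩
      h           ∎

cofactor-≥2 : ∀ q p → 2 ≤ q * p → p ≢ q * p → ∃[ n ] q ≡ 2 + n
cofactor-≥2 zero p () _
cofactor-≥2 (suc zero) p _ p≢p = ⊥-elim (p≢p (sym (*-identityˡ p)))
cofactor-≥2 (suc (suc n)) _ _ _ = n , refl

proposition4p4 : (a d u p : ℕ) → 1 ≤ d → gcd a d ≡ 1 → 3 ≤ u → 2 ≤ a →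
    .{{_ : NonZero p}} → p ∣ a → p ≢ a →
    IsFrobenius (λ x → x ∈⟨ gensA a d u ⟩/ p) (frobFormula a d u p)
-- The hypothesis 1 ≤ d is implied by gcd a d ≡ 1 and 2 ≤ a, hence unused.
proposition4p4 .(q * p) d u p _ gcd≡1 u≥3 a≥2 (divides q refl) p≢a
  with n , refl ← cofactor-≥2 q p a≥2 p≢a = quotient-frobenius n d u p gcd≡1 u≥3
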